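{- Let $C_n$ be the cycle graph on $n\ge 3$ vertices and $k$ a positive integer. For any integer $0\le j\le\lfloor n/2\rfloor$, $$\chi_j^k(C_n)=\begin{cases} 1 & \text{if } n \text{ is odd, } k=2, \text{ and } j=0,\\ n-2j & \text{if } k=1,\\ 0 & \text{otherwise.}\end{cases}$$
   Context: For a positive integer $k$, a nonnegative integer $j$ and a simple graph $G=(V,E)$, a set $E'\subseteq E$ is a $k$-chromatic number $j$-mixed edge removal set if there exists $V'\subseteq V$ with $|V'|=j$ such that $\chi(G-V'-E')\le k$, where $\chi$ is the chromatic number and $G-V'-E'$ is obtained from $G$ by deleting the vertices in $V'$ (with their incident edges) and the remaining edges of $E'$. The parameter $\chi_j^k(G)$ is the minimum of $|E'|$ over all $k$-chromatic number $j$-mixed edge removal sets $E'$. -}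

module Defs where

open import Data.Nat using (ℕ; suc; _+_; _≤_; NonZero; >-nonZero)
open import Data.Nat.Properties using (≤-trans)
open import Data.Nat.DivMod using (_mod_)
open import Data.Fin using (Fin; toℕ)
open import Data.Fin.Subset using (Subset; _∈_; _∉_; ∣_∣)
open import Data.List using (List; length; lookup; tabulate)
open import Data.Product using (_×_; _,_; proj₁; proj₂; Σ; ∃; ∃-syntax)
open import Relation.Binary.PropositionalEquality using (_≡_; _≢_)

record Graph (n : ℕ) : Set where
  field
    edges : List (Fin n × Fin n)

open Graph public

Edge : ∀ {n} → Graph n → Set
Edge G = Fin (length (edges G))

endpoints : ∀ {n} (G : Graph n) → Edge G → Fin n × Fin n
endpoints G e = lookup (edges G) e

cycleGraph : (n : ℕ) → .{{NonZero n}} → Graph n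
cycleGraph n = record { edges = tabulate (λ (i : Fin n) → (i , (toℕ i + 1) mod n)) }

Survives : ∀ {n} (G : Graph n) → Subset n → Subset (length (edges G)) → Edge G → Set
Survives G V' E' e =
  (e ∉ E') × (proj₁ (endpoints G e) ∉ V') × (proj₂ (endpoints G e) ∉ V')

-- χ(G - V' - E') ≤ k : the graph G - V' - E' has a proper colouring with
-- at most k colours (colours of deleted vertices are irrelevant).
ChromaticAtMost : ∀ {n} (G : Graph n) → Subset n → Subset (length (edges G)) → ℕ → Set
ChromaticAtMost {n} G V' E' k =
  Σ (Fin n → Fin k) λ c →
    (e : Edge G) → Survives G V' E' e →
      c (proj₁ (endpoints G e)) ≢ c (proj₂ (endpoints G e))

IsMixedRemovalSet : ∀ {n} (G : Graph n) (k j : ℕ) → Subset (length (edges G)) → Set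
IsMixedRemovalSet {n} G k j E' =
  Σ (Subset n) λ V' → (∣ V' ∣ ≡ j) × ChromaticAtMost G V' E' k

ChiJK≡ : ∀ {n} (G : Graph n) (k j m : ℕ) → Set
ChiJK≡ G k j m =
  (Σ (Subset (length (edges G))) λ E' → IsMixedRemovalSet G k j E' × (∣ E' ∣ ≡ m))
  × ((E' : Subset (length (edges G))) → IsMixedRemovalSet G k j E' → m ≤ ∣ E' ∣)

{-# OPTIONS --safe #-}
-- A proper colouring of the cycle alternates along every kept edge.  Two colours therefore
-- suffice exactly when n is even or the closing edge (n−1)—0 is gone (removed directly, or
-- vertex 0 deleted), so for an odd cycle with no deleted vertex one removed edge is necessary and
-- sufficient; three colours always suffice.  With one colour every edge must disappear: a
-- deleted vertex kills at most two edges, and deleting the vertices 1, 3, …, 2j−1 kills the 2j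
-- edges below 2j, leaving n − 2j edges to remove.
module Submission where

open import Algebra.Properties.CommutativeSemigroup using (interchange)
open import Data.Bool using (Bool; true; false; not; _∨_; _∧_; if_then_else_)
open import Data.Bool.Properties using (T-≡; not-injective)
open import Data.Fin using (Fin; zero; suc; toℕ; fromℕ<; cast)
open import Data.Fin.Properties using (toℕ-cast; toℕ-fromℕ<; toℕ-injective; cast-involutive; toℕ<n)
open import Data.Fin.Subset using (Subset; _∉_; ∣_∣; ⊥)
open import Data.Fin.Subset.Properties using (∣⊥∣≡0)
open import Data.List using (length)
open import Data.List.Properties using (length-tabulate; lookup-tabulate)
open import Data.Nat using (ℕ; zero; suc; _+_; _*_; _∸_; _/_; _%_; _≤_; _<_; z≤n; s≤s; _<ᵇ_; _≟_; >-nonZero)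
open import Data.Nat.DivMod using (_mod_; m%n<n; m<n⇒m%n≡m; n%n≡0; m%n%n≡m%n; m≡m%n+[m/n]*n; m/n*n≤m)
open import Data.Nat.Properties
open import Data.Product using (_×_; _,_; proj₁; proj₂; ∃-syntax)
open import Data.Sum using (_⊎_; inj₁; inj₂)
open import Data.Vec using ([]; _∷_; lookup; tabulate)
open import Data.Vec.Properties using (lookup⇒[]=; []=⇒lookup)
open import Function using (_∘_; _⇔_; mk⇔; Equivalence)
open import Relation.Binary.PropositionalEquality
open import Relation.Nullary using (¬_; contradiction; does)
open import Relation.Nullary.Decidable using (dec-true; dec-false)

open import Defs

bit : Bool → ℕ
bit false = 0
bit true = 1

bit-∨ : ∀ a b → bit (a ∨ b) ≤ bit a + bit b
bit-∨ false b = ≤-refl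
bit-∨ true b = s≤s z≤n

count : (ℕ → Bool) → ℕ → ℕ
count p zero = 0
count p (suc N) = bit (p 0) + count (p ∘ suc) N

count-cong : ∀ {p q} N → (∀ x → x < N → p x ≡ q x) → count p N ≡ count q N
count-cong zero eq = refl
count-cong (suc N) eq = cong₂ _+_ (cong bit (eq 0 (s≤s z≤n))) (count-cong N (λ x x<N → eq (suc x) (s≤s x<N)))

count-true : ∀ {p} N → (∀ x → x < N → p x ≡ true) → count p N ≡ N
count-true zero _ = refl
count-true (suc N) all rewrite all 0 (s≤s z≤n) = cong suc (count-true N (λ x x<N → all (suc x) (s≤s x<N)))

count-∨ : ∀ p q N → count (λ x → p x ∨ q x) N ≤ count p N + count q N
count-∨ p q zero = z≤n
count-∨ p q (suc N) = begin
  bit (p 0 ∨ q 0) + count (λ x → p (suc x) ∨ q (suc x)) N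
    ≤⟨ +-mono-≤ (bit-∨ (p 0) (q 0)) (count-∨ (p ∘ suc) (q ∘ suc) N) ⟩
  (bit (p 0) + bit (q 0)) + (count (p ∘ suc) N + count (q ∘ suc) N)
    ≡⟨ interchange +-commutativeSemigroup (bit (p 0)) (bit (q 0)) _ _ ⟩
  count p (suc N) + count q (suc N) ∎
  where open ≤-Reasoning

count-suc : ∀ p N → count p (suc N) ≡ count p N + bit (p N)
count-suc p zero = +-comm (bit (p 0)) 0
count-suc p (suc N) = trans (cong (bit (p 0) +_) (count-suc (p ∘ suc) N)) (sym (+-assoc (bit (p 0)) _ _))

count-rotate : ∀ p N (f : ℕ → ℕ) → (∀ x → x < N → f x ≡ suc x) → f N ≡ 0 →
               count (p ∘ f) (suc N) ≡ count p (suc N)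
count-rotate p N f shift wrap = begin
  count (p ∘ f) (suc N)           ≡⟨ count-suc (p ∘ f) N ⟩
  count (p ∘ f) N + bit (p (f N)) ≡⟨ cong₂ _+_ (count-cong N λ x x<N → cong p (shift x x<N)) (cong (bit ∘ p) wrap) ⟩
  count (p ∘ suc) N + bit (p 0)   ≡⟨ +-comm _ (bit (p 0)) ⟩
  count p (suc N)                 ∎
  where open ≡-Reasoning

-- Indices beyond the size of the subset are non-members.
infix 6 _∈ᵇ_
_∈ᵇ_ : ∀ {N} → ℕ → Subset N → Bool
x ∈ᵇ [] = false
zero ∈ᵇ (b ∷ v) = b
suc x ∈ᵇ (b ∷ v) = x ∈ᵇ v

∈ᵇ-toℕ : ∀ {N} (v : Subset N) i → toℕ i ∈ᵇ v ≡ lookup v i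
∈ᵇ-toℕ (b ∷ v) zero = refl
∈ᵇ-toℕ (b ∷ v) (suc i) = ∈ᵇ-toℕ v i

∉⇒∈ᵇ≡false : ∀ {N} (v : Subset N) i → i ∉ v → toℕ i ∈ᵇ v ≡ false
∉⇒∈ᵇ≡false v i i∉v with lookup v i in eq
... | true = contradiction (lookup⇒[]= i v eq) i∉v
... | false = trans (∈ᵇ-toℕ v i) eq

∈ᵇ≡false⇒∉ : ∀ {N} (v : Subset N) i → toℕ i ∈ᵇ v ≡ false → i ∉ v
∈ᵇ≡false⇒∉ v i i∉v i∈v with trans (sym ([]=⇒lookup i∈v)) (trans (sym (∈ᵇ-toℕ v i)) i∉v)
... | ()

∣∷∣ : ∀ {N} b (v : Subset N) → ∣ b ∷ v ∣ ≡ bit b + ∣ v ∣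
∣∷∣ false v = refl
∣∷∣ true v = refl

count-∈ᵇ≤∣∣ : ∀ {N} (v : Subset N) M → count (_∈ᵇ v) M ≤ ∣ v ∣
count-∈ᵇ≤∣∣ [] zero = z≤n
count-∈ᵇ≤∣∣ [] (suc M) = count-∈ᵇ≤∣∣ [] M
count-∈ᵇ≤∣∣ (b ∷ v) zero = z≤n
count-∈ᵇ≤∣∣ (b ∷ v) (suc M) rewrite ∣∷∣ b v = +-monoʳ-≤ (bit b) (count-∈ᵇ≤∣∣ v M)

∣v∣≡0⇒∈ᵇ≡false : ∀ {N} (v : Subset N) → ∣ v ∣ ≡ 0 → ∀ x → x ∈ᵇ v ≡ false
∣v∣≡0⇒∈ᵇ≡false [] _ x = refl
∣v∣≡0⇒∈ᵇ≡false (false ∷ v) _ zero = refl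
∣v∣≡0⇒∈ᵇ≡false (false ∷ v) ∣v∣≡0 (suc x) = ∣v∣≡0⇒∈ᵇ≡false v ∣v∣≡0 x

fromPred : ∀ {N} → (ℕ → Bool) → Subset N
fromPred p = tabulate (p ∘ toℕ)

∈ᵇ-fromPred : ∀ {N} p x → x < N → x ∈ᵇ fromPred {N} p ≡ p x
∈ᵇ-fromPred {suc N} p zero _ = refl
∈ᵇ-fromPred {suc N} p (suc x) (s≤s x<N) = ∈ᵇ-fromPred (p ∘ suc) x x<N

∣fromPred∣ : ∀ N p → ∣ fromPred {N} p ∣ ≡ count p N
∣fromPred∣ zero p = refl
∣fromPred∣ (suc N) p = trans (∣∷∣ (p 0) (fromPred {N} (p ∘ suc))) (cong (bit (p 0) +_) (∣fromPred∣ N (p ∘ suc)))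

count-<ᵇ : ∀ {a} N → a ≤ N → count (_<ᵇ a) N ≡ a
count-<ᵇ zero z≤n = refl
count-<ᵇ {zero} (suc N) z≤n = count-<ᵇ N z≤n
count-<ᵇ {suc a} (suc N) (s≤s a≤N) = cong suc (count-<ᵇ N a≤N)

count-≮ᵇ : ∀ a N → count (not ∘ (_<ᵇ a)) N ≡ N ∸ a
count-≮ᵇ zero zero = refl
count-≮ᵇ (suc a) zero = refl
count-≮ᵇ zero (suc N) = cong suc (count-≮ᵇ zero N)
count-≮ᵇ (suc a) (suc N) = count-≮ᵇ a N

<ᵇ-true : ∀ {x a} → x < a → (x <ᵇ a) ≡ true
<ᵇ-true {x} {a} x<a = Equivalence.to T-≡ (<⇒<ᵇ x<a)

<ᵇ≡true⇒< : ∀ {x a} → (x <ᵇ a) ≡ true → x < a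
<ᵇ≡true⇒< {x} {a} x<ᵇa = <ᵇ⇒< x a (Equivalence.from T-≡ x<ᵇa)

<ᵇ-irrefl : ∀ x → (x <ᵇ x) ≡ false
<ᵇ-irrefl zero = refl
<ᵇ-irrefl (suc x) = <ᵇ-irrefl x

odd : ℕ → Bool
odd zero = false
odd (suc zero) = true
odd (suc (suc x)) = odd x

odd-suc : ∀ x → odd (suc x) ≡ not (odd x)
odd-suc zero = refl
odd-suc (suc zero) = refl
odd-suc (suc (suc x)) = odd-suc x

odd-*2 : ∀ q → odd (q * 2) ≡ false
odd-*2 zero = refl
odd-*2 (suc q) = odd-*2 q

odd-*2+ : ∀ q r → odd (q * 2 + r) ≡ odd r
odd-*2+ zero r = refl
odd-*2+ (suc q) r = odd-*2+ q r

count-odd<ᵇ : ∀ j N → j * 2 ≤ N → count (λ x → (x <ᵇ j * 2) ∧ odd x) N ≡ j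
count-odd<ᵇ zero N _ = count-<ᵇ N z≤n
count-odd<ᵇ (suc j) (suc (suc N)) (s≤s (s≤s le)) = cong suc (count-odd<ᵇ j N le)

%2≡1⇒≡suc[/2*2] : ∀ N → N % 2 ≡ 1 → N ≡ suc (N / 2 * 2)
%2≡1⇒≡suc[/2*2] N N%2≡1 = trans (m≡m%n+[m/n]*n N 2) (cong (_+ N / 2 * 2) N%2≡1)

%2≢1⇒¬odd : ∀ N → N % 2 ≢ 1 → odd N ≡ false
%2≢1⇒¬odd N N%2≢1 = begin
  odd N                   ≡⟨ cong odd (trans (m≡m%n+[m/n]*n N 2) (+-comm (N % 2) _)) ⟩
  odd (N / 2 * 2 + N % 2) ≡⟨ odd-*2+ (N / 2) (N % 2) ⟩
  odd (N % 2)             ≡⟨ remainder (N % 2) (m%n<n N 2) N%2≢1 ⟩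
  false                   ∎
  where
  open ≡-Reasoning
  remainder : ∀ r → r < 2 → r ≢ 1 → odd r ≡ false
  remainder zero _ _ = refl
  remainder (suc zero) _ r≢1 = contradiction refl r≢1
  remainder (suc (suc r)) (s≤s (s≤s ())) _

parity : ∀ {k} → ℕ → Fin (suc (suc k))
parity x = if odd x then suc zero else zero

parity-suc : ∀ {k} x → parity {k} (suc x) ≢ parity x
parity-suc x rewrite odd-suc x with odd x
... | true = λ ()
... | false = λ ()

parity≢2 : ∀ {k} x → parity {suc k} x ≢ suc (suc zero)
parity≢2 x with odd x
... | true = λ ()
... | false = λ ()

parity≢parity0 : ∀ {k} x → odd (suc x) ≡ false → parity {k} x ≢ parity 0
parity≢parity0 x even rewrite odd-suc x with odd x
... | true = λ ()
parity≢parity0 x () | false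

Fin1-unique : ∀ (a b : Fin 1) → a ≡ b
Fin1-unique zero zero = refl

≢∧≢⇒≡ : ∀ {a b c : Fin 2} → a ≢ b → b ≢ c → a ≡ c
≢∧≢⇒≡ {zero} {zero} a≢b _ = contradiction refl a≢b
≢∧≢⇒≡ {zero} {suc zero} {zero} _ _ = refl
≢∧≢⇒≡ {zero} {suc zero} {suc zero} _ b≢c = contradiction refl b≢c
≢∧≢⇒≡ {suc zero} {zero} {zero} _ b≢c = contradiction refl b≢c
≢∧≢⇒≡ {suc zero} {zero} {suc zero} _ _ = refl
≢∧≢⇒≡ {suc zero} {suc zero} a≢b _ = contradiction refl a≢b

alternating-even : ∀ {N} (h : ℕ → Fin 2) → (∀ x → suc x < N → h x ≢ h (suc x)) →
                   ∀ q → q * 2 < N → h (q * 2) ≡ h 0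
alternating-even h proper zero _ = refl
alternating-even {N} h proper (suc q) sq*2<N = begin
  h (suc (suc (q * 2))) ≡⟨ ≢∧≢⇒≡ (proper (suc (q * 2)) sq*2<N ∘ sym) (proper (q * 2) (<-trans (n<1+n _) sq*2<N) ∘ sym) ⟩
  h (q * 2)             ≡⟨ alternating-even h proper q (<-trans (<-trans (n<1+n _) (n<1+n _)) sq*2<N) ⟩
  h 0                   ∎
  where open ≡-Reasoning

∀-toℕ⇒∀< : ∀ {N} {P : ℕ → Set} → (∀ (i : Fin N) → P (toℕ i)) → ∀ x → x < N → P x
∀-toℕ⇒∀< {P = P} f x x<N = subst P (toℕ-fromℕ< x<N) (f (fromℕ< x<N))

module Cycle (ℓ : ℕ) where

  n : ℕ
  n = suc ℓ

  C : Graph n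
  C = cycleGraph n

  cycleEdge : Fin n → Fin n × Fin n
  cycleEdge i = (i , (toℕ i + 1) mod n)

  EdgeSet : Set
  EdgeSet = Subset (length (edges C))

  #edges≡n : length (edges C) ≡ n
  #edges≡n = length-tabulate cycleEdge

  edgeAt : Fin n → Edge C
  edgeAt = cast (sym #edges≡n)

  endpoints-edgeAt : ∀ i → endpoints C (edgeAt i) ≡ (i , (toℕ i + 1) mod n)
  endpoints-edgeAt = lookup-tabulate cycleEdge

  -- Vertices and edges of C are addressed by their index below n; edge x joins x and next x.
  next : ℕ → ℕ
  next x = (x + 1) % n

  next-< : ∀ {x} → suc x < n → next x ≡ suc x
  next-< {x} sx<n = trans (cong (_% n) (+-comm x 1)) (m<n⇒m%n≡m sx<n)

  next-last : ∀ {x} → suc x ≡ n → next x ≡ 0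
  next-last {x} sx≡n = trans (cong (_% n) (trans (+-comm x 1) sx≡n)) (n%n≡0 n)

  toℕ-mod : ∀ x → toℕ (x mod n) ≡ x % n
  toℕ-mod x = toℕ-fromℕ< (m%n<n x n)

  Kept : Subset n → EdgeSet → ℕ → Set
  Kept V E x = (x ∈ᵇ E ≡ false) × (x ∈ᵇ V ≡ false) × (next x ∈ᵇ V ≡ false)

  survives⇔kept : ∀ {V E} i → Survives C V E (edgeAt i) ⇔ Kept V E (toℕ i)
  survives⇔kept {V} {E} i = mk⇔
    (λ (e∉E , a∉V , b∉V) →
        trans (cong (_∈ᵇ E) (sym (toℕ-cast _ i))) (∉⇒∈ᵇ≡false E (edgeAt i) e∉E)
      , ∉⇒∈ᵇ≡false V i (subst (_∉ V) (cong proj₁ endpoints≡) a∉V)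
      , trans (cong (_∈ᵇ V) (sym (toℕ-mod (toℕ i + 1))))
              (∉⇒∈ᵇ≡false V _ (subst (_∉ V) (cong proj₂ endpoints≡) b∉V)))
    (λ (i∉E , i∉V , next∉V) →
        ∈ᵇ≡false⇒∉ E (edgeAt i) (trans (cong (_∈ᵇ E) (toℕ-cast _ i)) i∉E)
      , subst (_∉ V) (sym (cong proj₁ endpoints≡)) (∈ᵇ≡false⇒∉ V i i∉V)
      , subst (_∉ V) (sym (cong proj₂ endpoints≡))
              (∈ᵇ≡false⇒∉ V _ (trans (cong (_∈ᵇ V) (toℕ-mod (toℕ i + 1))) next∉V)))
    where
    endpoints≡ : endpoints C (edgeAt i) ≡ (i , (toℕ i + 1) mod n)
    endpoints≡ = endpoints-edgeAt i

  ProperOn : ∀ {k} → Subset n → EdgeSet → (ℕ → Fin k) → Set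
  ProperOn V E h = ∀ x → x < n → Kept V E x → h x ≢ h (next x)

  toℕ-mod-id : ∀ i → toℕ i mod n ≡ i
  toℕ-mod-id i = toℕ-injective (trans (toℕ-mod (toℕ i)) (m<n⇒m%n≡m (toℕ<n i)))

  %-mod : ∀ x → x % n mod n ≡ x mod n
  %-mod x = toℕ-injective (trans (toℕ-mod (x % n)) (trans (m%n%n≡m%n x n) (sym (toℕ-mod x))))

  properOn⇒chromatic : ∀ {k V E} (h : ℕ → Fin k) → ProperOn V E h → ChromaticAtMost C V E k
  properOn⇒chromatic {V = V} {E} h proper =
    h ∘ toℕ , λ e → subst Good (cast-involutive (sym #edges≡n) #edges≡n e) (good (cast #edges≡n e))
    where
    Good : Edge C → Set
    Good e = Survives C V E e → h (toℕ (proj₁ (endpoints C e))) ≢ h (toℕ (proj₂ (endpoints C e)))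
    good : ∀ i → Good (edgeAt i)
    good i surv = subst (λ (a , b) → h (toℕ a) ≢ h (toℕ b)) (sym (endpoints-edgeAt i))
      λ same → proper (toℕ i) (toℕ<n i) (Equivalence.to (survives⇔kept i) surv)
                 (trans same (cong h (toℕ-mod (toℕ i + 1))))

  chromatic⇒properOn : ∀ {k V E} → ChromaticAtMost C V E k → ∃[ h ] ProperOn {k} V E h
  chromatic⇒properOn {V = V} {E} (c , proper) = c ∘ (_mod n) , ∀-toℕ⇒∀< {P = P} good
    where
    P : ℕ → Set
    P x = Kept V E x → c (x mod n) ≢ c (next x mod n)
    good : ∀ i → P (toℕ i)
    good i kept rewrite toℕ-mod-id i | %-mod (toℕ i + 1) =
      subst (λ (a , b) → c a ≢ c b) (endpoints-edgeAt i) (proper (edgeAt i) (Equivalence.from (survives⇔kept i) kept))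

  parity-properOn : ∀ {k V E} → (∀ x → suc x ≡ n → Kept V E x → parity {k} x ≢ parity 0) → ProperOn V E (parity {k})
  parity-properOn {k} wrap x x<n kept with m≤n⇒m<n∨m≡n x<n
  ... | inj₁ sx<n = subst (λ y → parity {k} x ≢ parity y) (sym (next-< sx<n)) (parity-suc x ∘ sym)
  ... | inj₂ sx≡n = subst (λ y → parity {k} x ≢ parity y) (sym (next-last sx≡n)) (wrap x sx≡n kept)

  -- The parity colouring can only fail on the closing edge ℓ—0, and only when n is odd.
  twoColourable : ∀ {V E} → n % 2 ≢ 1 ⊎ ℓ ∈ᵇ E ≡ true ⊎ 0 ∈ᵇ V ≡ true → ChromaticAtMost C V E 2
  twoColourable {V} {E} (inj₁ n%2≢1) =
    properOn⇒chromatic parity (parity-properOn {V = V} {E} λ x sx≡n _ →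
      parity≢parity0 x (trans (cong odd sx≡n) (%2≢1⇒¬odd n n%2≢1)))
  twoColourable {V} {E} (inj₂ (inj₁ ℓ∈E)) =
    properOn⇒chromatic parity (parity-properOn {V = V} {E} λ x sx≡n (x∉E , _) →
      contradiction (trans (sym x∉E) (trans (cong (_∈ᵇ E) (suc-injective sx≡n)) ℓ∈E)) λ ())
  twoColourable {V} {E} (inj₂ (inj₂ 0∈V)) =
    properOn⇒chromatic parity (parity-properOn {V = V} {E} λ x sx≡n (_ , _ , next∉V) →
      contradiction (trans (sym next∉V) (trans (cong (_∈ᵇ V) (next-last sx≡n)) 0∈V)) λ ())

  triColour : ∀ {k} → ℕ → Fin (3 + k)
  triColour x = if does (suc x ≟ n) then suc (suc zero) else parity x

  triColour-last : ∀ {k x} → suc x ≡ n → triColour {k} x ≡ suc (suc zero)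
  triColour-last {x = x} sx≡n rewrite dec-true (suc x ≟ n) sx≡n = refl

  triColour-inner : ∀ {k x} → suc x ≢ n → triColour {k} x ≡ parity x
  triColour-inner {x = x} sx≢n rewrite dec-false (suc x ≟ n) sx≢n = refl

  threeColourable : 1 ≤ ℓ → ∀ {k V E} → ChromaticAtMost C V E (3 + k)
  threeColourable 1≤ℓ {k} {V} {E} = properOn⇒chromatic triColour proper
    where
    proper : ProperOn V E (triColour {k})
    proper x x<n _ with m≤n⇒m<n∨m≡n x<n
    ... | inj₂ sx≡n = subst (λ y → triColour {k} x ≢ triColour y) (sym (next-last sx≡n)) λ same →
      parity≢2 0 (trans (sym (triColour-inner (<⇒≢ (s≤s 1≤ℓ)))) (trans (sym same) (triColour-last sx≡n)))
    ... | inj₁ sx<n with m≤n⇒m<n∨m≡n sx<n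
    ...   | inj₂ ssx≡n = subst (λ y → triColour {k} x ≢ triColour y) (sym (next-< sx<n)) λ same →
      parity≢2 x (trans (sym (triColour-inner (<⇒≢ sx<n))) (trans same (triColour-last ssx≡n)))
    ...   | inj₁ ssx<n = subst (λ y → triColour {k} x ≢ triColour y) (sym (next-< sx<n)) λ same →
      parity-suc x (trans (sym (triColour-inner (<⇒≢ ssx<n))) (trans (sym same) (triColour-inner (<⇒≢ sx<n))))

  odd-cycle-¬2-colourable : n % 2 ≡ 1 → (h : ℕ → Fin 2) → ¬ (∀ x → x < n → h x ≢ h (next x))
  odd-cycle-¬2-colourable n%2≡1 h proper = proper (n / 2 * 2) last<n (trans lastColour (cong h (sym (next-last sLast≡n))))
    where
    sLast≡n : suc (n / 2 * 2) ≡ n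
    sLast≡n = sym (%2≡1⇒≡suc[/2*2] n n%2≡1)
    last<n : n / 2 * 2 < n
    last<n = ≤-reflexive sLast≡n
    path : ∀ x → suc x < n → h x ≢ h (suc x)
    path x sx<n = subst (λ y → h x ≢ h y) (next-< sx<n) (proper x (<-trans (n<1+n x) sx<n))
    lastColour : h (n / 2 * 2) ≡ h 0
    lastColour = alternating-even h path (n / 2) last<n

  removed : Subset n → EdgeSet → ℕ → Bool
  removed V E x = x ∈ᵇ E ∨ (x ∈ᵇ V ∨ next x ∈ᵇ V)

  ¬kept⇒removed : ∀ {V E} x → ¬ Kept V E x → removed V E x ≡ true
  ¬kept⇒removed {V} {E} x ¬kept with x ∈ᵇ E | x ∈ᵇ V | next x ∈ᵇ V
  ... | true  | _     | _     = refl
  ... | false | true  | _     = refl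
  ... | false | false | true  = refl
  ... | false | false | false = contradiction (refl , refl , refl) ¬kept

  count-next : ∀ p → count (p ∘ next) n ≡ count p n
  count-next p = count-rotate p ℓ next (λ x x<ℓ → next-< (s≤s x<ℓ)) (next-last refl)

  allRemoved⇒n≤∣E∣+2∣V∣ : ∀ {V E} → (∀ x → x < n → ¬ Kept V E x) → n ≤ ∣ E ∣ + (∣ V ∣ + ∣ V ∣)
  allRemoved⇒n≤∣E∣+2∣V∣ {V} {E} cover = begin
    n
      ≡⟨ count-true {removed V E} n (λ x x<n → ¬kept⇒removed {V} {E} x (cover x x<n)) ⟨
    count (removed V E) n
      ≤⟨ count-∨ (_∈ᵇ E) (λ x → x ∈ᵇ V ∨ next x ∈ᵇ V) n ⟩
    count (_∈ᵇ E) n + count (λ x → x ∈ᵇ V ∨ next x ∈ᵇ V) n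
      ≤⟨ +-monoʳ-≤ (count (_∈ᵇ E) n) (count-∨ (_∈ᵇ V) ((_∈ᵇ V) ∘ next) n) ⟩
    count (_∈ᵇ E) n + (count (_∈ᵇ V) n + count ((_∈ᵇ V) ∘ next) n)
      ≡⟨ cong (λ c → count (_∈ᵇ E) n + (count (_∈ᵇ V) n + c)) (count-next (_∈ᵇ V)) ⟩
    count (_∈ᵇ E) n + (count (_∈ᵇ V) n + count (_∈ᵇ V) n)
      ≤⟨ +-mono-≤ (count-∈ᵇ≤∣∣ E n) (+-mono-≤ (count-∈ᵇ≤∣∣ V n) (count-∈ᵇ≤∣∣ V n)) ⟩
    ∣ E ∣ + (∣ V ∣ + ∣ V ∣) ∎
    where open ≤-Reasoning

  firstVertices : ℕ → Subset n
  firstVertices j = fromPred (_<ᵇ j)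

  ∣firstVertices∣ : ∀ {j} → j ≤ n → ∣ firstVertices j ∣ ≡ j
  ∣firstVertices∣ {j} j≤n = trans (∣fromPred∣ n (_<ᵇ j)) (count-<ᵇ n j≤n)

  oddVerticesBelow : ℕ → Subset n
  oddVerticesBelow a = fromPred (λ x → (x <ᵇ a) ∧ odd x)

  ∣oddVerticesBelow∣ : ∀ {j} → j * 2 ≤ n → ∣ oddVerticesBelow (j * 2) ∣ ≡ j
  ∣oddVerticesBelow∣ {j} j*2≤n = trans (∣fromPred∣ n (λ x → (x <ᵇ j * 2) ∧ odd x)) (count-odd<ᵇ j n j*2≤n)

  ∈ᵇ-oddVerticesBelow : ∀ a {x} → x < n → x ∈ᵇ oddVerticesBelow a ≡ (x <ᵇ a) ∧ odd x
  ∈ᵇ-oddVerticesBelow a {x} = ∈ᵇ-fromPred (λ x → (x <ᵇ a) ∧ odd x) x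

  edgesFrom : ℕ → EdgeSet
  edgesFrom a = fromPred (not ∘ (_<ᵇ a))

  ∣edgesFrom∣ : ∀ a → ∣ edgesFrom a ∣ ≡ n ∸ a
  ∣edgesFrom∣ a = begin
    ∣ edgesFrom a ∣                          ≡⟨ ∣fromPred∣ (length (edges C)) (not ∘ (_<ᵇ a)) ⟩
    count (not ∘ (_<ᵇ a)) (length (edges C)) ≡⟨ count-≮ᵇ a (length (edges C)) ⟩
    length (edges C) ∸ a                     ≡⟨ cong (_∸ a) #edges≡n ⟩
    n ∸ a                                    ∎
    where open ≡-Reasoning

  ∈ᵇ-edgesFrom : ∀ a {x} → x < n → x ∈ᵇ edgesFrom a ≡ not (x <ᵇ a)
  ∈ᵇ-edgesFrom a {x} x<n = ∈ᵇ-fromPred (not ∘ (_<ᵇ a)) x (subst (x <_) (sym #edges≡n) x<n)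

  oddVerticesBelow-edgesFrom-¬kept : ∀ {j} → j * 2 ≤ n →
    ∀ x → x < n → ¬ Kept (oddVerticesBelow (j * 2)) (edgesFrom (j * 2)) x
  oddVerticesBelow-edgesFrom-¬kept {j} j*2≤n x x<n (x∉E , x∉V , next∉V) =
    contradiction (trans (sym next∉V) next∈V) λ ()
    where
    x<2j : x < j * 2
    x<2j = <ᵇ≡true⇒< (not-injective (trans (sym (∈ᵇ-edgesFrom (j * 2) x<n)) x∉E))
    evenX : odd x ≡ false
    evenX = trans (cong (_∧ odd x) (sym (<ᵇ-true x<2j))) (trans (sym (∈ᵇ-oddVerticesBelow (j * 2) x<n)) x∉V)
    oddSx : odd (suc x) ≡ true
    oddSx = trans (odd-suc x) (cong not evenX)
    sx<2j : suc x < j * 2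
    sx<2j = ≤∧≢⇒< x<2j λ sx≡2j → contradiction (trans (sym oddSx) (trans (cong odd sx≡2j) (odd-*2 j))) λ ()
    sx<n : suc x < n
    sx<n = ≤-trans sx<2j j*2≤n
    next∈V : next x ∈ᵇ oddVerticesBelow (j * 2) ≡ true
    next∈V = begin
      next x ∈ᵇ oddVerticesBelow (j * 2) ≡⟨ cong (_∈ᵇ oddVerticesBelow (j * 2)) (next-< sx<n) ⟩
      suc x ∈ᵇ oddVerticesBelow (j * 2)  ≡⟨ ∈ᵇ-oddVerticesBelow (j * 2) sx<n ⟩
      (suc x <ᵇ j * 2) ∧ odd (suc x)     ≡⟨ cong₂ _∧_ (<ᵇ-true sx<2j) oddSx ⟩
      true                               ∎
      where open ≡-Reasoning

  oneColour⇒¬kept : ∀ {V E} → ChromaticAtMost C V E 1 → ∀ x → x < n → ¬ Kept V E x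
  oneColour⇒¬kept colourable x x<n kept =
    let (h , proper) = chromatic⇒properOn colourable in
    proper x x<n kept (Fin1-unique (h x) (h (next x)))

  χ²₀≡1 : n % 2 ≡ 1 → ChiJK≡ C 2 0 1
  χ²₀≡1 n%2≡1 =
      (edgesFrom ℓ , (firstVertices 0 , ∣firstVertices∣ z≤n , twoColourable (inj₂ (inj₁ ℓ∈E))) , ∣E∣≡1)
    , atLeastOne
    where
    ℓ∈E : ℓ ∈ᵇ edgesFrom ℓ ≡ true
    ℓ∈E = trans (∈ᵇ-edgesFrom ℓ ≤-refl) (cong not (<ᵇ-irrefl ℓ))
    ∣E∣≡1 : ∣ edgesFrom ℓ ∣ ≡ 1
    ∣E∣≡1 = trans (∣edgesFrom∣ ℓ) (m+n∸n≡m 1 ℓ)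
    atLeastOne : ∀ E → IsMixedRemovalSet C 2 0 E → 1 ≤ ∣ E ∣
    atLeastOne E (V , ∣V∣≡0 , colourable) = n≢0⇒n>0 λ ∣E∣≡0 →
      let (h , proper) = chromatic⇒properOn colourable
          kept : ∀ x → Kept V E x
          kept x = ∣v∣≡0⇒∈ᵇ≡false E ∣E∣≡0 x , ∣v∣≡0⇒∈ᵇ≡false V ∣V∣≡0 x , ∣v∣≡0⇒∈ᵇ≡false V ∣V∣≡0 (next x)
      in odd-cycle-¬2-colourable n%2≡1 h λ x x<n → proper x x<n (kept x)

  χ¹ⱼ≡n∸2j : ∀ {j} → j * 2 ≤ n → ChiJK≡ C 1 j (n ∸ 2 * j)
  χ¹ⱼ≡n∸2j {j} j*2≤n =
      (edgesFrom (j * 2) , (oddVerticesBelow (j * 2) , ∣oddVerticesBelow∣ j*2≤n , monochromatic) , ∣E∣≡n∸2j)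
    , atLeast
    where
    monochromatic : ChromaticAtMost C (oddVerticesBelow (j * 2)) (edgesFrom (j * 2)) 1
    monochromatic = properOn⇒chromatic (λ _ → zero) λ x x<n kept _ →
      oddVerticesBelow-edgesFrom-¬kept {j} j*2≤n x x<n kept
    ∣E∣≡n∸2j : ∣ edgesFrom (j * 2) ∣ ≡ n ∸ 2 * j
    ∣E∣≡n∸2j = trans (∣edgesFrom∣ (j * 2)) (cong (n ∸_) (*-comm j 2))
    atLeast : ∀ E → IsMixedRemovalSet C 1 j E → n ∸ 2 * j ≤ ∣ E ∣
    atLeast E (V , ∣V∣≡j , colourable) = m≤n+o⇒m∸n≤o n (2 * j) (begin
      n                        ≤⟨ allRemoved⇒n≤∣E∣+2∣V∣ {V} {E} (oneColour⇒¬kept colourable) ⟩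
      ∣ E ∣ + (∣ V ∣ + ∣ V ∣)  ≡⟨ cong (λ v → ∣ E ∣ + (v + v)) ∣V∣≡j ⟩
      ∣ E ∣ + (j + j)          ≡⟨ +-comm ∣ E ∣ (j + j) ⟩
      j + j + ∣ E ∣            ≡⟨ cong (λ v → j + v + ∣ E ∣) (+-identityʳ j) ⟨
      2 * j + ∣ E ∣            ∎)
      where open ≤-Reasoning

  χⱼ≡0 : ∀ {k j} → j ≤ n → ChromaticAtMost C (firstVertices j) ⊥ k → ChiJK≡ C k j 0
  χⱼ≡0 {j = j} j≤n colourable =
      (⊥ , (firstVertices j , ∣firstVertices∣ j≤n , colourable) , ∣⊥∣≡0 (length (edges C)))
    , λ _ _ → z≤n

  χ²ⱼ≡0 : ∀ {j} → j ≤ n → ¬ (n % 2 ≡ 1 × j ≡ 0) → ChiJK≡ C 2 j 0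
  χ²ⱼ≡0 {zero} j≤n ¬oddCycle = χⱼ≡0 j≤n (twoColourable (inj₁ λ n%2≡1 → ¬oddCycle (n%2≡1 , refl)))
  χ²ⱼ≡0 {suc j} j≤n _ = χⱼ≡0 j≤n (twoColourable (inj₂ (inj₂ (∈ᵇ-fromPred {n} (_<ᵇ suc j) 0 (s≤s z≤n)))))

mainTheorem9 : (n : ℕ) → (n≥3 : 3 ≤ n) → (k : ℕ) → 1 ≤ k → (j : ℕ) → j ≤ n / 2 →
    let C = cycleGraph n {{>-nonZero (≤-trans (s≤s z≤n) n≥3)}} in
    ((n % 2 ≡ 1) → k ≡ 2 → j ≡ 0 → ChiJK≡ C k j 1)
    × (k ≡ 1 → ChiJK≡ C k j (n ∸ 2 * j))
    × (¬ ((n % 2 ≡ 1) × (k ≡ 2) × (j ≡ 0)) → k ≢ 1 → ChiJK≡ C k j 0)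
mainTheorem9 n@(suc ℓ@(suc (suc _))) (s≤s (s≤s (s≤s z≤n))) k 1≤k j j≤n/2 =
  (λ { n%2≡1 refl refl → χ²₀≡1 n%2≡1 }) , (λ { refl → χ¹ⱼ≡n∸2j j*2≤n }) , χᵏⱼ≡0 k 1≤k
  where
  open Cycle ℓ hiding (n)
  j*2≤n : j * 2 ≤ n
  j*2≤n = ≤-trans (*-monoˡ-≤ 2 j≤n/2) (m/n*n≤m n 2)
  j≤n : j ≤ n
  j≤n = ≤-trans (m≤m*n j 2) j*2≤n
  χᵏⱼ≡0 : ∀ k → 1 ≤ k → ¬ (n % 2 ≡ 1 × k ≡ 2 × j ≡ 0) → k ≢ 1 → ChiJK≡ C k j 0
  χᵏⱼ≡0 0 () _ _
  χᵏⱼ≡0 1 _ _ k≢1 = contradiction refl k≢1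
  χᵏⱼ≡0 2 _ ¬exception _ = χ²ⱼ≡0 j≤n λ (n%2≡1 , j≡0) → ¬exception (n%2≡1 , refl , j≡0)
  χᵏⱼ≡0 (suc (suc (suc k))) _ _ _ = χⱼ≡0 j≤n (threeColourable (s≤s z≤n))
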